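{- Let $H$ be a graph and $G$ be a subgraph of $H$ with at least one edge and with matching number $\nu$. Then (i) $\mathrm{cms}(H) \leq \frac{\nu|E(H)|}{|E(G)|}$; and (ii) $\mathrm{cms}(H) \leq \dfrac{|E(H)|}{\left\lfloor \frac{1}{\nu}(|E(G)|-\mathrm{cms}(G)) \right\rfloor+1}$.
   Context: All graphs are simple; two edges are adjacent if they share a vertex; the matching number is the maximum size of a matching. An ordering of a graph $G$ with $m$ edges is a bijection $\ell:E(G)\to\mathbb{Z}_m$; $d_\ell(e,e')$ is the smallest positive integer $d$ with $\ell(e)+d=\ell(e')$ in $\mathbb{Z}_m$, $d_\ell\{e,e'\}=\min\{d_\ell(e,e'),d_\ell(e',e)\}$; $\mathrm{cms}(\ell)$ is the largest $s\in\{1,\dots,m\}$ with $d_\ell\{e,e'\}\geq s$ for every pair of adjacent edges, and $\mathrm{cms}(G)$ is the maximum of $\mathrm{cms}(\ell)$ over all orderings of $G$. -}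

module Defs where

open import Data.Nat using (ℕ; zero; suc; _+_; _*_; _∸_; _≤_; _<_; _/_)
open import Data.Nat.Properties using (_<?_)
open import Data.Fin using (Fin; toℕ)
open import Data.Fin.Permutation using (Permutation′; _⟨$⟩ʳ_)
open import Data.Product using (Σ; _×_; _,_; proj₁; proj₂; ∃)
open import Data.Sum using (_⊎_)
open import Data.List using (List; length)
open import Data.List.Relation.Unary.Unique.Propositional using (Unique)
open import Data.List.Relation.Unary.AllPairs using (AllPairs)
open import Function.Definitions using (Injective)
open import Relation.Binary.PropositionalEquality using (_≡_; _≢_)
open import Relation.Nullary using (¬_; yes; no)

-- Each edge is a pair (u , v) with u < v (no loops, canonical orientation),
-- and distinct indices give distinct edges (no multi-edges).
record Graph (n : ℕ) : Set where
  field
    m      : ℕ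
    edge   : Fin m → Fin n × Fin n
    lt     : ∀ i → toℕ (proj₁ (edge i)) < toℕ (proj₂ (edge i))
    inj    : Injective _≡_ _≡_ edge
open Graph public

∣E∣ : ∀ {n} → Graph n → ℕ
∣E∣ G = m G

_⊆G_ : ∀ {n} → Graph n → Graph n → Set
G ⊆G H = ∀ (i : Fin (m G)) → ∃ λ (j : Fin (m H)) → edge G i ≡ edge H j

ShareVertex : ∀ {n} → Fin n × Fin n → Fin n × Fin n → Set
ShareVertex (a , b) (c , d) = (a ≡ c) ⊎ (a ≡ d) ⊎ (b ≡ c) ⊎ (b ≡ d)

Adjacent : ∀ {n} (G : Graph n) → Fin (m G) → Fin (m G) → Set
Adjacent G i j = (i ≢ j) × ShareVertex (edge G i) (edge G j)

IsMatching : ∀ {n} (G : Graph n) → List (Fin (m G)) → Set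
IsMatching G M = Unique M × AllPairs (λ i j → ¬ Adjacent G i j) M

IsMatchingNumber : ∀ {n} → Graph n → ℕ → Set
IsMatchingNumber G ν =
  (Σ (List (Fin (m G))) λ M → IsMatching G M × length M ≡ ν)
  × (∀ M → IsMatching G M → length M ≤ ν)

-- an ordering: a bijection E(G) → ℤ_m (ℤ_m represented by Fin m)
Ordering : ∀ {n} → Graph n → Set
Ordering G = Permutation′ (m G)

-- d(a, a') in ℤ_k: the smallest positive d with a + d = a' (mod k)
cdist : (k : ℕ) → Fin k → Fin k → ℕ
cdist k a a' with toℕ a <? toℕ a'
... | yes _ = toℕ a' ∸ toℕ a
... | no  _ = (k + toℕ a') ∸ toℕ a

-- d_ℓ{e,e'} = min of the two directed distances; "≥ s" for both
Separated : ∀ {n} (G : Graph n) → Ordering G → ℕ → Set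
Separated G ℓ s = ∀ (e e' : Fin (m G)) → Adjacent G e e' →
  (s ≤ cdist (m G) (ℓ ⟨$⟩ʳ e) (ℓ ⟨$⟩ʳ e')) × (s ≤ cdist (m G) (ℓ ⟨$⟩ʳ e') (ℓ ⟨$⟩ʳ e))

Admissible : ∀ {n} (G : Graph n) → Ordering G → ℕ → Set
Admissible G ℓ s = (1 ≤ s) × (s ≤ m G) × Separated G ℓ s

-- c = cms(G) = max over orderings ℓ of cms(ℓ), where cms(ℓ) is the largest
-- admissible s.  Equivalently c is the largest s admissible for some ℓ.
IsCms : ∀ {n} → Graph n → ℕ → Set
IsCms G c =
  (Σ (Ordering G) λ ℓ → Admissible G ℓ c)
  × (∀ (ℓ : Ordering G) (s : ℕ) → Admissible G ℓ s → s ≤ c)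

-- floor division a / b on ℕ (only used with b ≥ 1; value 0 when b = 0)
_div_ : ℕ → ℕ → ℕ
a div zero = zero
a div suc b = a / suc b

-- Fix an ordering ℓ of H with cms(ℓ) = c and mark the positions ℓ(e), e ∈ E(G), on ℤ_N with
-- N = |E(H)|. Edges of G at positions less than c apart are not adjacent, so every window of c
-- consecutive positions holds at most ν marked points; averaging over the N windows gives (i).
-- For (ii) order E(G) as the marked points appear along ℤ_N. If c (q + 1) > N, where
-- q = ⌊(|E(G)| − cms(G)) / ν⌋, then for adjacent e, e' the arc from ℓ(e') round to ℓ(e) is
-- covered by q windows, hence holds at most q ν marked points; so e and e' are at distance at
-- least |E(G)| + 1 − q ν > cms(G) in this ordering of G, which is impossible.

module Submission where

open import Defs
open import Data.Bool using (Bool; true; false)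
open import Data.Empty using (⊥-elim)
open import Data.Fin using (Fin; toℕ; fromℕ<; punchOut)
open import Data.Fin.Properties using (toℕ-injective; toℕ<n; toℕ-fromℕ<; punchOut-injective; any?; injective⇒≤)
  renaming (_≟_ to _≟ᶠ_)
open import Data.Fin.Permutation using (Permutation′; _⟨$⟩ʳ_; _⟨$⟩ˡ_; inverseˡ; permutation)
open import Data.List using (List; []; _∷_; length; filter; allFin)
open import Data.List.Properties using (length-tabulate)
open import Data.List.Membership.Propositional using (_∈_)
open import Data.List.Membership.Propositional.Properties using (∈-allFin)
open import Data.List.Relation.Unary.All as All using (All; []; _∷_)
open import Data.List.Relation.Unary.All.Properties using (all-filter)
open import Data.List.Relation.Unary.AllPairs as AllPairs using (AllPairs; []; _∷_)
import Data.List.Relation.Unary.AllPairs.Properties as AllPairsₚ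
open import Data.List.Relation.Unary.Any using (here; there)
open import Data.List.Relation.Unary.Unique.Propositional using (Unique)
import Data.List.Relation.Unary.Unique.Propositional.Properties as Uniqueₚ
open import Data.Nat using (ℕ; zero; suc; _+_; _*_; _∸_; _≤_; _<_; _≤?_; _<?_; z≤n; s≤s; s≤s⁻¹; _/_)
open import Data.Nat.DivMod using (m/n*n≤m)
open import Data.Nat.Properties
open import Algebra.Properties.CommutativeSemigroup +-commutativeSemigroup using (interchange; x∙yz≈yx∙z)
open import Data.Product using (∃; _×_; _,_; proj₁; proj₂)
open import Data.Sum using (_⊎_; inj₁; inj₂)
open import Function.Definitions using (Injective)
open import Relation.Unary using (Decidable)
open import Relation.Nullary using (¬_; yes; no; contradiction)
open import Relation.Binary using (tri<; tri≈; tri>)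
open import Relation.Binary.PropositionalEquality

∑ : {A : Set} → List A → (A → ℕ) → ℕ
∑ []       f = 0
∑ (x ∷ xs) f = f x + ∑ xs f

module _ {A : Set} where

  ∑-cong : ∀ xs {f g : A → ℕ} → (∀ x → f x ≡ g x) → ∑ xs f ≡ ∑ xs g
  ∑-cong []       f≗g = refl
  ∑-cong (x ∷ xs) f≗g = cong₂ _+_ (f≗g x) (∑-cong xs f≗g)

  ∑-distrib-+ : ∀ xs (f g : A → ℕ) → ∑ xs (λ x → f x + g x) ≡ ∑ xs f + ∑ xs g
  ∑-distrib-+ []       f g = refl
  ∑-distrib-+ (x ∷ xs) f g =
    trans (cong (f x + g x +_) (∑-distrib-+ xs f g)) (interchange (f x) (g x) (∑ xs f) (∑ xs g))

  ∑-one : ∀ (xs : List A) → ∑ xs (λ _ → 1) ≡ length xs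
  ∑-one []       = refl
  ∑-one (x ∷ xs) = cong suc (∑-one xs)

  ∑-zero : ∀ (xs : List A) → ∑ xs (λ _ → 0) ≡ 0
  ∑-zero []       = refl
  ∑-zero (x ∷ xs) = ∑-zero xs

  ∈⇒≤∑ : ∀ {xs x} (f : A → ℕ) → x ∈ xs → f x ≤ ∑ xs f
  ∈⇒≤∑ f (here refl)           = m≤m+n _ _
  ∈⇒≤∑ {y ∷ _} f (there x∈xs) = ≤-trans (∈⇒≤∑ f x∈xs) (m≤n+m _ (f y))

  ∑≤length-support : ∀ xs (u : A → ℕ) (supp? : Decidable (λ x → 1 ≤ u x)) → (∀ x → u x ≤ 1) →
                     ∑ xs u ≤ length (filter supp? xs)
  ∑≤length-support []       u supp? u≤1 = z≤n
  ∑≤length-support (x ∷ xs) u supp? u≤1 with supp? x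
  ... | yes _   = +-mono-≤ (u≤1 x) (∑≤length-support xs u supp? u≤1)
  ... | no  u≱1 = +-mono-≤ (s≤s⁻¹ (≰⇒> u≱1)) (∑≤length-support xs u supp? u≤1)

∑< : ℕ → (ℕ → ℕ) → ℕ
∑< zero    f = 0
∑< (suc n) f = ∑< n f + f n

∑<-+ : ∀ m n (f : ℕ → ℕ) → ∑< (m + n) f ≡ ∑< m f + ∑< n (λ t → f (m + t))
∑<-+ m zero    f = trans (cong (λ k → ∑< k f) (+-identityʳ m)) (sym (+-identityʳ _))
∑<-+ m (suc n) f rewrite +-suc m n | ∑<-+ m n f = +-assoc (∑< m f) _ (f (m + n))

∑<-cong : ∀ n {f g : ℕ → ℕ} → (∀ t → t < n → f t ≡ g t) → ∑< n f ≡ ∑< n g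
∑<-cong zero    f≗g = refl
∑<-cong (suc n) f≗g = cong₂ _+_ (∑<-cong n (λ t t<n → f≗g t (m<n⇒m<1+n t<n))) (f≗g n ≤-refl)

∑<-mono : ∀ n {f g : ℕ → ℕ} → (∀ t → f t ≤ g t) → ∑< n f ≤ ∑< n g
∑<-mono zero    f≤g = z≤n
∑<-mono (suc n) f≤g = +-mono-≤ (∑<-mono n f≤g) (f≤g n)

∑<-+-const : ∀ n (f : ℕ → ℕ) k → ∑< n (λ t → f t + k) ≡ ∑< n f + n * k
∑<-+-const zero    f k = refl
∑<-+-const (suc n) f k rewrite ∑<-+-const n f k =
  trans (interchange (∑< n f) (n * k) (f n) k) (cong (∑< n f + f n +_) (+-comm (n * k) k))

below : ℕ → ℕ → ℕ
below z p with p <? z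
... | yes _ = 1
... | no  _ = 0

between : ℕ → ℕ → ℕ → ℕ
between x y p = below y p ∸ below x p

below-true : ∀ {p z} → p < z → below z p ≡ 1
below-true {p} {z} p<z with p <? z
... | yes _   = refl
... | no  p≮z = contradiction p<z p≮z

below-false : ∀ {p z} → ¬ p < z → below z p ≡ 0
below-false {p} {z} p≮z with p <? z
... | yes p<z = contradiction p<z p≮z
... | no  _   = refl

below-≤1 : ∀ z p → below z p ≤ 1
below-≤1 z p with p <? z
... | yes _ = ≤-refl
... | no  _ = z≤n

below-mono : ∀ p {x y} → x ≤ y → below x p ≤ below y p
below-mono p {x} {y} x≤y with p <? x
... | no  _   = z≤n
... | yes p<x = ≤-reflexive (sym (below-true (<-≤-trans p<x x≤y)))

between-≤1 : ∀ x y p → between x y p ≤ 1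
between-≤1 x y p = ≤-trans (m∸n≤m (below y p) (below x p)) (below-≤1 y p)

between-split : ∀ p {x y} → x ≤ y → below y p ≡ below x p + between x y p
between-split p x≤y = sym (m+[n∸m]≡n (below-mono p x≤y))

between-bounds : ∀ x y p → 1 ≤ between x y p → x ≤ p × p < y
between-bounds x y p 1≤b with p <? y | p <? x
... | yes p<y | no p≮x = ≮⇒≥ p≮x , p<y
... | yes _   | yes _  = contradiction 1≤b λ ()
... | no  _   | yes _  = contradiction 1≤b λ ()
... | no  _   | no  _  = contradiction 1≤b λ ()

between-self : ∀ p → between p (suc p) p ≡ 1
between-self p rewrite below-true (n<1+n p) | below-false (n≮n p) = refl

-- For x, y < N, ahead N x y is the representative of y in (x, x + N], so that
-- cdistℕ N x y is the forward distance from x to y in ℤ_N.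
ahead : ℕ → ℕ → ℕ → ℕ
ahead N x y with x <? y
... | yes _ = y
... | no  _ = N + y

cdistℕ : ℕ → ℕ → ℕ → ℕ
cdistℕ N x y = ahead N x y ∸ x

cdist≡cdistℕ : ∀ N (a a' : Fin N) → cdist N a a' ≡ cdistℕ N (toℕ a) (toℕ a')
cdist≡cdistℕ N a a' with toℕ a <? toℕ a'
... | yes _ = refl
... | no  _ = refl

ahead-< : ∀ N {x y} → x < y → ahead N x y ≡ y
ahead-< N {x} {y} x<y with x <? y
... | yes _   = refl
... | no  x≮y = contradiction x<y x≮y

ahead-≮ : ∀ N {x y} → ¬ x < y → ahead N x y ≡ N + y
ahead-≮ N {x} {y} x≮y with x <? y
... | yes x<y = contradiction x<y x≮y
... | no  _   = refl

ahead≤ : ∀ N x y → ahead N x y ≤ N + y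
ahead≤ N x y with x <? y
... | yes _ = m≤n+m y N
... | no  _ = ≤-refl

<-ahead : ∀ N {x} y → x < N → x < ahead N x y
<-ahead N {x} y x<N with x <? y
... | yes x<y = x<y
... | no  _   = <-≤-trans x<N (m≤m+n N y)

Fin-injective⇒surjective : ∀ {n} (f : Fin n → Fin n) → Injective _≡_ _≡_ f →
                           ∀ y → ∃ λ x → f x ≡ y
Fin-injective⇒surjective {suc n} f f-inj y with any? (λ x → f x ≟ᶠ y)
... | yes hit = hit
... | no  miss = contradiction (injective⇒≤ g-inj) 1+n≰n
  where
  g : Fin (suc n) → Fin n
  g x = punchOut {i = y} {j = f x} (λ y≡fx → miss (x , sym y≡fx))
  g-inj : Injective _≡_ _≡_ g
  g-inj {x} {x'} gx≡gx' =
    f-inj (punchOut-injective {i = y} (λ e → miss (x , sym e)) (λ e → miss (x' , sym e)) gx≡gx')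

Fin-injective⇒permutation : ∀ {n} (f : Fin n → Fin n) → Injective _≡_ _≡_ f → Permutation′ n
Fin-injective⇒permutation f f-inj =
  permutation f (λ y → proj₁ (onto y)) (λ y → proj₂ (onto y)) (λ x → f-inj (proj₂ (onto (f x))))
  where onto = Fin-injective⇒surjective f f-inj

≤1-exclusive : ∀ {x y} → x ≤ 1 → y ≤ 1 → ¬ (1 ≤ x × 1 ≤ y) → x + y ≤ 1
≤1-exclusive {zero}             _        y≤1 _     = y≤1
≤1-exclusive {suc zero} {zero}  _        _   _     = ≤-refl
≤1-exclusive {suc zero} {suc _} _        _   ¬both = contradiction (s≤s z≤n , s≤s z≤n) ¬both
≤1-exclusive {suc (suc _)}      (s≤s ()) _   _

m+[1+n]≤o+p⇒m+1≤o∸n+p : ∀ m n o p → m + suc n ≤ o + p → m + 1 ≤ (o ∸ n) + p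
m+[1+n]≤o+p⇒m+1≤o∸n+p m n o p le = begin
  m + 1        ≤⟨ m+n≤o⇒m≤o∸n (m + 1) (subst (_≤ o + p) (sym (+-assoc m 1 n)) le) ⟩
  (o + p) ∸ n  ≤⟨ m≤n+o⇒m∸n≤o (o + p) n o+p≤n+[o∸n+p] ⟩
  (o ∸ n) + p  ∎
  where
  open ≤-Reasoning
  o+p≤n+[o∸n+p] : o + p ≤ n + ((o ∸ n) + p)
  o+p≤n+[o∸n+p] = subst (o + p ≤_) (+-assoc n (o ∸ n) p) (+-monoˡ-≤ p (m≤n+m∸n o n))

AllPairs-discharge : ∀ {A : Set} {P : A → Set} {R : A → A → Set} {xs : List A} →
                     All P xs → AllPairs (λ x y → P x → P y → R x y) xs → AllPairs R xs
AllPairs-discharge []         []         = []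
AllPairs-discharge (px ∷ pxs) (rs ∷ rss) =
  All.zipWith (λ (r , py) → r px py) (rs , pxs) ∷ AllPairs-discharge pxs rss

module Count {e : ℕ} (pos : Fin e → ℕ) where

  count : ℕ → ℕ
  count z = ∑ (allFin e) λ k → below z (pos k)

  count-split : ∀ {x y} → x ≤ y → count y ≡ count x + ∑ (allFin e) (λ k → between x y (pos k))
  count-split {x} {y} x≤y =
    trans (∑-cong (allFin e) (λ k → between-split (pos k) x≤y))
          (∑-distrib-+ (allFin e) (λ k → below x (pos k)) (λ k → between x y (pos k)))

  count-mono : ∀ {x y} → x ≤ y → count x ≤ count y
  count-mono x≤y = subst (_ ≤_) (sym (count-split x≤y)) (m≤m+n _ _)

  count-zero : count 0 ≡ 0
  count-zero = trans (∑-cong (allFin e) (λ k → below-false {pos k} {0} λ ())) (∑-zero (allFin e))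

  count-all : ∀ {z} → (∀ k → pos k < z) → count z ≡ e
  count-all pos<z = begin
    count _                     ≡⟨ ∑-cong (allFin e) (λ k → below-true (pos<z k)) ⟩
    ∑ (allFin e) (λ _ → 1)      ≡⟨ ∑-one (allFin e) ⟩
    length (allFin e)           ≡⟨ length-tabulate (λ k → k) ⟩
    e                           ∎
    where open ≡-Reasoning

  count-step : ∀ k → suc (count (pos k)) ≤ count (suc (pos k))
  count-step k = begin
    suc (count p)                       ≡⟨ +-comm 1 (count p) ⟩
    count p + 1                         ≡⟨ cong (count p +_) (sym (between-self p)) ⟩
    count p + between p (suc p) (pos k) ≤⟨ +-monoʳ-≤ (count p) (∈⇒≤∑ step (∈-allFin k)) ⟩
    count p + ∑ (allFin e) step         ≡⟨ count-split (n≤1+n p) ⟨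
    count (suc p)                       ∎
    where
    p = pos k
    step : Fin e → ℕ
    step k' = between p (suc p) (pos k')
    open ≤-Reasoning

module Cyclic (N c : ℕ) {e : ℕ} (pos : Fin e → ℕ) (pos<N : ∀ k → pos k < N)
              (pos-injective : ∀ {k k'} → pos k ≡ pos k' → k ≡ k') (c≤N : c ≤ N) where

  open Count pos

  -- The circle unrolled twice: each position p is counted at p and at N + p, so the
  -- marked points in any cyclic window of length c ≤ N are counted by count₂ on an interval.
  count₂ : ℕ → ℕ
  count₂ z = count z + count (z ∸ N)

  count₂-mono : ∀ {x y} → x ≤ y → count₂ x ≤ count₂ y
  count₂-mono x≤y = +-mono-≤ (count-mono x≤y) (count-mono (∸-monoˡ-≤ N x≤y))

  count₂-small : ∀ {z} → z ≤ N → count₂ z ≡ count z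
  count₂-small {z} z≤N = begin
    count z + count (z ∸ N) ≡⟨ cong (λ w → count z + count w) (m≤n⇒m∸n≡0 z≤N) ⟩
    count z + count 0       ≡⟨ cong (count z +_) count-zero ⟩
    count z + 0             ≡⟨ +-identityʳ (count z) ⟩
    count z                 ∎
    where open ≡-Reasoning

  count₂-wrap : ∀ t → count₂ (N + t) ≡ e + count t
  count₂-wrap t =
    cong₂ _+_ (count-all (λ k → <-≤-trans (pos<N k) (m≤m+n N t))) (cong count (m+n∸m≡n N t))

  rank : Fin e → ℕ
  rank k = count (pos k)

  rank-mono : ∀ {k k'} → pos k < pos k' → rank k < rank k'
  rank-mono {k} p<p' = ≤-trans (count-step k) (count-mono p<p')

  rank<e : ∀ k → rank k < e
  rank<e k = ≤-trans (count-step k) (≤-trans (count-mono (pos<N k)) (≤-reflexive (count-all pos<N)))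

  rank-injective : ∀ {k k'} → rank k ≡ rank k' → k ≡ k'
  rank-injective {k} {k'} r≡r' with <-cmp (pos k) (pos k')
  ... | tri< p<p' _ _ = contradiction r≡r' (<⇒≢ (rank-mono p<p'))
  ... | tri≈ _ p≡p' _ = pos-injective p≡p'
  ... | tri> _ _ p'<p = contradiction (sym r≡r') (<⇒≢ (rank-mono p'<p))

  ahead-rank : ∀ {k k'} → k ≢ k' → ahead e (rank k) (rank k') ≡ count₂ (ahead N (pos k) (pos k'))
  ahead-rank {k} {k'} k≢k' with <-cmp (pos k) (pos k')
  ... | tri< p<p' _ _ = begin
    ahead e (rank k) (rank k')        ≡⟨ ahead-< e (rank-mono p<p') ⟩
    rank k'                           ≡⟨ count₂-small (<⇒≤ (pos<N k')) ⟨
    count₂ (pos k')                   ≡⟨ cong count₂ (ahead-< N p<p') ⟨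
    count₂ (ahead N (pos k) (pos k')) ∎
    where open ≡-Reasoning
  ... | tri≈ _ p≡p' _ = contradiction (pos-injective p≡p') k≢k'
  ... | tri> p≮p' _ p'<p = begin
    ahead e (rank k) (rank k')        ≡⟨ ahead-≮ e (<⇒≯ (rank-mono p'<p)) ⟩
    e + rank k'                       ≡⟨ count₂-wrap (pos k') ⟨
    count₂ (N + pos k')               ≡⟨ cong count₂ (ahead-≮ N p≮p') ⟨
    count₂ (ahead N (pos k) (pos k')) ∎
    where open ≡-Reasoning

  unroll : Bool → ℕ → ℕ
  unroll false p = p
  unroll true  p = N + p

  unroll-injective : ∀ {p p'} b b' → p < N → p' < N → unroll b p ≡ unroll b' p' → p ≡ p'
  unroll-injective false false _   _    eq = eq
  unroll-injective {p} {p'} false true  p<N _    eq = contradiction (subst (_< N) eq p<N) (m+n≮m N p')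
  unroll-injective {p} {p'} true  false _   p'<N eq =
    contradiction (subst (_< N) (sym eq) p'<N) (m+n≮m N p)
  unroll-injective true  true  _   _    eq = +-cancelˡ-≡ N _ _ eq

  cdistℕ≤unroll : ∀ {p p'} b b' → p' < N → unroll b p < unroll b' p' →
                  cdistℕ N p p' ≤ unroll b' p' ∸ unroll b p
  cdistℕ≤unroll {p} false false _ p<p' = ≤-reflexive (cong (_∸ p) (ahead-< N p<p'))
  cdistℕ≤unroll {p} {p'} false true _ _ = ∸-monoˡ-≤ p (ahead≤ N p p')
  cdistℕ≤unroll {p} true false p'<N N+p<p' = contradiction (<-trans N+p<p' p'<N) (m+n≮m N p)
  cdistℕ≤unroll {p} {p'} true true _ N+p<N+p' = begin
    ahead N p p' ∸ p        ≡⟨ cong (_∸ p) (ahead-< N (+-cancelˡ-< N p p' N+p<N+p')) ⟩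
    p' ∸ p                  ≡⟨ [m+n]∸[m+o]≡n∸o N p' p ⟨
    (N + p') ∸ (N + p)      ∎
    where open ≤-Reasoning

  unroll-close : ∀ {p p'} b b' → p' < N → unroll b p < unroll b' p' → unroll b' p' < unroll b p + c →
                 cdistℕ N p p' < c
  unroll-close {p} {p'} b b' p'<N x<y y<x+c = begin-strict
    cdistℕ N p p'           ≤⟨ cdistℕ≤unroll b b' p'<N x<y ⟩
    y ∸ x                   <⟨ ∸-monoˡ-< y<x+c (<⇒≤ x<y) ⟩
    (x + c) ∸ x             ≡⟨ m+n∸m≡n x c ⟩
    c                       ∎
    where
    x = unroll b p
    y = unroll b' p'
    open ≤-Reasoning

  Near : Fin e → Fin e → Set
  Near k k' = cdistℕ N (pos k) (pos k') < c ⊎ cdistℕ N (pos k') (pos k) < c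

  module Windows (ν : ℕ) (cluster-bound : ∀ L → Unique L → AllPairs Near L → length L ≤ ν) where

    module Window (a : ℕ) where

      direct wrapped weight : Fin e → ℕ
      direct  k = between a (a + c) (pos k)
      wrapped k = between (a ∸ N) ((a + c) ∸ N) (pos k)
      weight  k = direct k + wrapped k

      count₂-window : count₂ (a + c) ≡ count₂ a + ∑ (allFin e) weight
      count₂-window = begin
        count₂ (a + c)
          ≡⟨ cong₂ _+_ (count-split (m≤m+n a c)) (count-split (∸-monoˡ-≤ N (m≤m+n a c))) ⟩
        (count a + ∑ (allFin e) direct) + (count (a ∸ N) + ∑ (allFin e) wrapped)
          ≡⟨ interchange (count a) (∑ (allFin e) direct) (count (a ∸ N)) (∑ (allFin e) wrapped) ⟩
        count₂ a + (∑ (allFin e) direct + ∑ (allFin e) wrapped)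
          ≡⟨ cong (count₂ a +_) (∑-distrib-+ (allFin e) direct wrapped) ⟨
        count₂ a + ∑ (allFin e) weight
          ∎
        where open ≡-Reasoning

      wrapped-end≤a : (a + c) ∸ N ≤ a
      wrapped-end≤a = subst ((a + c) ∸ N ≤_) (m+n∸n≡m a N) (∸-monoˡ-≤ N (+-monoʳ-≤ a c≤N))

      weight≤1 : ∀ k → weight k ≤ 1
      weight≤1 k = ≤1-exclusive (between-≤1 a (a + c) p) (between-≤1 (a ∸ N) ((a + c) ∸ N) p)
        λ (direct≥1 , wrapped≥1) →
          n≮n p (<-≤-trans (proj₂ (between-bounds (a ∸ N) ((a + c) ∸ N) p wrapped≥1))
                           (≤-trans wrapped-end≤a (proj₁ (between-bounds a (a + c) p direct≥1))))
        where p = pos k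

      weight⇒unroll : ∀ k → 1 ≤ weight k → ∃ λ b → a ≤ unroll b (pos k) × unroll b (pos k) < a + c
      weight⇒unroll k weight≥1 with 1 ≤? direct k
      ... | yes direct≥1 = false , between-bounds a (a + c) (pos k) direct≥1
      ... | no  direct≱1 = true , a≤N+p , N+p<a+c
        where
        wrapped≥1 : 1 ≤ wrapped k
        wrapped≥1 = ≤-trans weight≥1 (+-monoˡ-≤ (wrapped k) (s≤s⁻¹ (≰⇒> direct≱1)))
        a∸N≤p : a ∸ N ≤ pos k
        a∸N≤p = proj₁ (between-bounds (a ∸ N) ((a + c) ∸ N) (pos k) wrapped≥1)
        p<a+c∸N : pos k < (a + c) ∸ N
        p<a+c∸N = proj₂ (between-bounds (a ∸ N) ((a + c) ∸ N) (pos k) wrapped≥1)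
        a≤N+p : a ≤ N + pos k
        a≤N+p = ≤-trans (m≤n+m∸n a N) (+-monoʳ-≤ N a∸N≤p)
        N+p<a+c : N + pos k < a + c
        N+p<a+c with N ≤? a + c
        ... | yes N≤a+c = subst (N + pos k <_) (m+[n∸m]≡n N≤a+c) (+-monoʳ-< N p<a+c∸N)
        ... | no  N≰a+c = contradiction (subst (pos k <_) (m≤n⇒m∸n≡0 (<⇒≤ (≰⇒> N≰a+c))) p<a+c∸N) λ ()

      weight-near : ∀ {k k'} → k ≢ k' → 1 ≤ weight k → 1 ≤ weight k' → Near k k'
      weight-near {k} {k'} k≢k' w≥1 w'≥1 with weight⇒unroll k w≥1 | weight⇒unroll k' w'≥1
      ... | b , a≤x , x<a+c | b' , a≤y , y<a+c with <-cmp (unroll b (pos k)) (unroll b' (pos k'))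
      ...   | tri< x<y _ _ =
        inj₁ (unroll-close b b' (pos<N k') x<y (<-≤-trans y<a+c (+-monoˡ-≤ c a≤x)))
      ...   | tri≈ _ x≡y _ =
        contradiction (pos-injective (unroll-injective b b' (pos<N k) (pos<N k') x≡y)) k≢k'
      ...   | tri> _ _ y<x =
        inj₂ (unroll-close b' b (pos<N k) y<x (<-≤-trans x<a+c (+-monoˡ-≤ c a≤y)))

      ∑weight≤ν : ∑ (allFin e) weight ≤ ν
      ∑weight≤ν = ≤-trans (∑≤length-support (allFin e) weight supp? weight≤1)
                          (cluster-bound support support-unique support-near)
        where
        supp? = λ k → 1 ≤? weight k
        support = filter supp? (allFin e)
        support-unique : Unique support
        support-unique = Uniqueₚ.filter⁺ supp? (Uniqueₚ.allFin⁺ e)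
        support-near : AllPairs Near support
        support-near = AllPairs-discharge (all-filter supp? (allFin e))
                                          (AllPairsₚ.filter⁺ supp? (AllPairsₚ.tabulate⁺ weight-near))

    window : ∀ a → count₂ (a + c) ≤ count₂ a + ν
    window a = subst (_≤ count₂ a + ν) (sym count₂-window) (+-monoʳ-≤ (count₂ a) ∑weight≤ν)
      where open Window a

    windows : ∀ q a → count₂ (a + q * c) ≤ count₂ a + q * ν
    windows zero    a = ≤-reflexive (trans (cong count₂ (+-identityʳ a)) (sym (+-identityʳ _)))
    windows (suc q) a = begin
      count₂ (a + (c + q * c))  ≡⟨ cong count₂ (+-assoc a c (q * c)) ⟨
      count₂ ((a + c) + q * c)  ≤⟨ windows q (a + c) ⟩
      count₂ (a + c) + q * ν    ≤⟨ +-monoˡ-≤ (q * ν) (window a) ⟩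
      (count₂ a + ν) + q * ν    ≡⟨ +-assoc (count₂ a) ν (q * ν) ⟩
      count₂ a + (ν + q * ν)    ∎
      where open ≤-Reasoning

    -- The window bound summed over a < N telescopes to c e = ∑_{t<c} (count₂ (N + t) ∸ count₂ t).
    c*e≤N*ν : c * e ≤ N * ν
    c*e≤N*ν = +-cancelˡ-≤ (A + B) (c * e) (N * ν) (begin
      (A + B) + c * e    ≡⟨ sum-from-N ⟨
      ∑< (N + c) count₂  ≡⟨ cong (λ n → ∑< n count₂) (+-comm N c) ⟩
      ∑< (c + N) count₂  ≤⟨ sum-from-c ⟩
      (A + B) + N * ν    ∎)
      where
      A = ∑< N count₂
      B = ∑< c count₂
      open ≤-Reasoning
      wrap : ∀ t → t < c → count₂ (N + t) ≡ count₂ t + e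
      wrap t t<c = begin-equality
        count₂ (N + t)  ≡⟨ count₂-wrap t ⟩
        e + count t     ≡⟨ +-comm e (count t) ⟩
        count t + e     ≡⟨ cong (_+ e) (count₂-small (≤-trans (<⇒≤ t<c) c≤N)) ⟨
        count₂ t + e    ∎
      sum-from-N : ∑< (N + c) count₂ ≡ (A + B) + c * e
      sum-from-N = begin-equality
        ∑< (N + c) count₂                ≡⟨ ∑<-+ N c count₂ ⟩
        A + ∑< c (λ t → count₂ (N + t))  ≡⟨ cong (A +_) (∑<-cong c wrap) ⟩
        A + ∑< c (λ t → count₂ t + e)    ≡⟨ cong (A +_) (∑<-+-const c count₂ e) ⟩
        A + (B + c * e)                  ≡⟨ +-assoc A B (c * e) ⟨
        (A + B) + c * e                  ∎
      window′ : ∀ t → count₂ (c + t) ≤ count₂ t + ν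
      window′ t = subst (λ z → count₂ z ≤ count₂ t + ν) (+-comm t c) (window t)
      sum-from-c : ∑< (c + N) count₂ ≤ (A + B) + N * ν
      sum-from-c = begin
        ∑< (c + N) count₂                ≡⟨ ∑<-+ c N count₂ ⟩
        B + ∑< N (λ t → count₂ (c + t))  ≤⟨ +-monoʳ-≤ B (∑<-mono N window′) ⟩
        B + ∑< N (λ t → count₂ t + ν)    ≡⟨ cong (B +_) (∑<-+-const N count₂ ν) ⟩
        B + (A + N * ν)                  ≡⟨ x∙yz≈yx∙z B A (N * ν) ⟩
        (A + B) + N * ν                  ∎

    -- The positions from ahead N (pos k) (pos k') round to pos k + N form an arc of length at
    -- most N + 1 ∸ c ≤ q c, so they hold at most q ν marked points.
    rank-gap : ∀ q → N + 1 ≤ q * c + c → ∀ {k k'} → k ≢ k' → c ≤ cdistℕ N (pos k) (pos k') →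
               e + 1 ≤ cdistℕ e (rank k) (rank k') + q * ν
    rank-gap q N+1≤qc+c {k} {k'} k≢k' c≤d = begin
      e + 1                                ≤⟨ m+[1+n]≤o+p⇒m+1≤o∸n+p e (rank k) (count₂ y) (q * ν) gap ⟩
      (count₂ y ∸ rank k) + q * ν          ≡⟨ cong (λ z → (z ∸ rank k) + q * ν) (ahead-rank k≢k') ⟨
      cdistℕ e (rank k) (rank k') + q * ν  ∎
      where
      open ≤-Reasoning
      p = pos k
      y = ahead N p (pos k')
      p+c≤y : p + c ≤ y
      p+c≤y = subst (p + c ≤_) (m+[n∸m]≡n (<⇒≤ (<-ahead N (pos k') (pos<N k)))) (+-monoʳ-≤ p c≤d)
      reach : N + suc p ≤ y + q * c
      reach = begin
        N + suc p        ≡⟨ +-assoc N 1 p ⟨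
        (N + 1) + p      ≤⟨ +-monoˡ-≤ p N+1≤qc+c ⟩
        (q * c + c) + p  ≡⟨ trans (+-assoc (q * c) c p) (cong (q * c +_) (+-comm c p)) ⟩
        q * c + (p + c)  ≤⟨ +-monoʳ-≤ (q * c) p+c≤y ⟩
        q * c + y        ≡⟨ +-comm (q * c) y ⟩
        y + q * c        ∎
      gap : e + suc (rank k) ≤ count₂ y + q * ν
      gap = begin
        e + suc (count p)   ≤⟨ +-monoʳ-≤ e (count-step k) ⟩
        e + count (suc p)   ≡⟨ count₂-wrap (suc p) ⟨
        count₂ (N + suc p)  ≤⟨ count₂-mono reach ⟩
        count₂ (y + q * c)  ≤⟨ windows q y ⟩
        count₂ y + q * ν    ∎

ShareVertex-sym : ∀ {n} (x y : Fin n × Fin n) → ShareVertex x y → ShareVertex y x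
ShareVertex-sym _ _ (inj₁ a≡c)                 = inj₁ (sym a≡c)
ShareVertex-sym _ _ (inj₂ (inj₁ a≡d))          = inj₂ (inj₂ (inj₁ (sym a≡d)))
ShareVertex-sym _ _ (inj₂ (inj₂ (inj₁ b≡c)))   = inj₂ (inj₁ (sym b≡c))
ShareVertex-sym _ _ (inj₂ (inj₂ (inj₂ b≡d)))   = inj₂ (inj₂ (inj₂ (sym b≡d)))

Adjacent-sym : ∀ {n} (G : Graph n) {i j} → Adjacent G i j → Adjacent G j i
Adjacent-sym G {i} {j} (i≢j , share) = (λ j≡i → i≢j (sym j≡i)) , ShareVertex-sym (edge G i) (edge G j) share

module Embedding {n} (G H : Graph n) (G⊆H : G ⊆G H) where

  embed : Fin (∣E∣ G) → Fin (∣E∣ H)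
  embed k = proj₁ (G⊆H k)

  embed-injective : Injective _≡_ _≡_ embed
  embed-injective {k} {k'} eq =
    inj G (trans (proj₂ (G⊆H k)) (trans (cong (edge H) eq) (sym (proj₂ (G⊆H k')))))

  embed-adjacent : ∀ {k k'} → Adjacent G k k' → Adjacent H (embed k) (embed k')
  embed-adjacent {k} {k'} (k≢k' , share) =
    (λ eq → k≢k' (embed-injective eq)) , subst₂ ShareVertex (proj₂ (G⊆H k)) (proj₂ (G⊆H k')) share

module Bounds {n} (H G : Graph n) (G⊆H : G ⊆G H) (ν : ℕ)
              (matching-bound : ∀ M → IsMatching G M → length M ≤ ν)
              (c : ℕ) (ℓ : Ordering H) (c≤N : c ≤ ∣E∣ H) (separated : Separated H ℓ c) where

  open Embedding G H G⊆H

  N e : ℕ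
  N = ∣E∣ H
  e = ∣E∣ G

  pos : Fin e → ℕ
  pos k = toℕ (ℓ ⟨$⟩ʳ embed k)

  pos-injective : ∀ {k k'} → pos k ≡ pos k' → k ≡ k'
  pos-injective {k} {k'} eq = embed-injective (begin
    embed k                         ≡⟨ inverseˡ ℓ ⟨
    ℓ ⟨$⟩ˡ (ℓ ⟨$⟩ʳ embed k)         ≡⟨ cong (ℓ ⟨$⟩ˡ_) (toℕ-injective eq) ⟩
    ℓ ⟨$⟩ˡ (ℓ ⟨$⟩ʳ embed k')        ≡⟨ inverseˡ ℓ ⟩
    embed k'                        ∎)
    where open ≡-Reasoning

  open Cyclic N c pos (λ k → toℕ<n (ℓ ⟨$⟩ʳ embed k)) pos-injective c≤N

  adjacent⇒far : ∀ {k k'} → Adjacent G k k' → c ≤ cdistℕ N (pos k) (pos k')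
  adjacent⇒far {k} {k'} adj =
    subst (c ≤_) (cdist≡cdistℕ N (ℓ ⟨$⟩ʳ embed k) (ℓ ⟨$⟩ʳ embed k'))
          (proj₁ (separated (embed k) (embed k') (embed-adjacent adj)))

  near⇒¬adjacent : ∀ {k k'} → Near k k' → ¬ Adjacent G k k'
  near⇒¬adjacent (inj₁ d<c) adj = <⇒≱ d<c (adjacent⇒far adj)
  near⇒¬adjacent (inj₂ d<c) adj = <⇒≱ d<c (adjacent⇒far (Adjacent-sym G adj))

  open Windows ν (λ L unique near → matching-bound L (unique , AllPairs.map near⇒¬adjacent near))

  c*e≤ν*N : c * e ≤ ν * N
  c*e≤ν*N = subst (c * e ≤_) (*-comm N ν) c*e≤N*ν

  rank-fin : Fin e → Fin e
  rank-fin k = fromℕ< (rank<e k)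

  rank-fin-injective : Injective _≡_ _≡_ rank-fin
  rank-fin-injective {k} {k'} eq = rank-injective (begin
    rank k             ≡⟨ toℕ-fromℕ< (rank<e k) ⟨
    toℕ (rank-fin k)   ≡⟨ cong toℕ eq ⟩
    toℕ (rank-fin k')  ≡⟨ toℕ-fromℕ< (rank<e k') ⟩
    rank k'            ∎)
    where open ≡-Reasoning

  rank-ordering : Ordering G
  rank-ordering = Fin-injective⇒permutation rank-fin rank-fin-injective

  cdist-rank-ordering : ∀ k k' → cdist e (rank-ordering ⟨$⟩ʳ k) (rank-ordering ⟨$⟩ʳ k') ≡
                                 cdistℕ e (rank k) (rank k')
  cdist-rank-ordering k k' =
    trans (cdist≡cdistℕ e (rank-fin k) (rank-fin k'))
          (cong₂ (cdistℕ e) (toℕ-fromℕ< (rank<e k)) (toℕ-fromℕ< (rank<e k')))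

  rank-ordering-far : ∀ q → N + 1 ≤ q * c + c → ∀ {k k'} → Adjacent G k k' →
                      (e + 1) ∸ q * ν ≤ cdist e (rank-ordering ⟨$⟩ʳ k) (rank-ordering ⟨$⟩ʳ k')
  rank-ordering-far q N+1≤qc+c {k} {k'} adj =
    m≤n+o⇒m∸n≤o (e + 1) (q * ν) (subst (e + 1 ≤_) reorder gap)
    where
    gap : e + 1 ≤ cdistℕ e (rank k) (rank k') + q * ν
    gap = rank-gap q N+1≤qc+c (proj₁ adj) (adjacent⇒far adj)
    reorder : cdistℕ e (rank k) (rank k') + q * ν ≡
              q * ν + cdist e (rank-ordering ⟨$⟩ʳ k) (rank-ordering ⟨$⟩ʳ k')
    reorder = trans (+-comm _ (q * ν)) (cong (q * ν +_) (sym (cdist-rank-ordering k k')))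

  rank-ordering-admissible : ∀ q → N + 1 ≤ q * c + c → 1 ≤ q * ν → q * ν ≤ e →
                             Admissible G rank-ordering ((e + 1) ∸ q * ν)
  rank-ordering-admissible q N+1≤qc+c 1≤qν qν≤e =
    subst (_≤ (e + 1) ∸ q * ν) (m+n∸m≡n e 1) (∸-monoʳ-≤ (e + 1) qν≤e) ,
    m≤n+o⇒m∸n≤o (e + 1) (q * ν) (subst (e + 1 ≤_) (+-comm e (q * ν)) (+-monoʳ-≤ e 1≤qν)) ,
    λ k k' adj → rank-ordering-far q N+1≤qc+c adj , rank-ordering-far q N+1≤qc+c (Adjacent-sym G adj)

  module _ (cG : ℕ) (cG≤e : cG ≤ e) (cG-max : ∀ ρ s → Admissible G ρ s → s ≤ cG) where

    -- If c (q + 1) > N, the ordering of E(G) along ℓ would have cms larger than cG.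
    c*[q+1]≤N : ∀ q → 1 ≤ ν → q * ν ≤ e ∸ cG → c * (q + 1) ≤ N
    c*[q+1]≤N zero    _   _     = subst (_≤ N) (sym (*-identityʳ c)) c≤N
    c*[q+1]≤N (suc q) 1≤ν Q≤e∸cG with c * (suc q + 1) ≤? N
    ... | yes fits    = fits
    ... | no  too-big = contradiction (cG-max rank-ordering ((e + 1) ∸ Q) admissible) (<⇒≱ cG<s)
      where
      Q = suc q * ν
      N+1≤qc+c : N + 1 ≤ suc q * c + c
      N+1≤qc+c = subst₂ _≤_ (+-comm 1 N) c*[q+1]≡qc+c (≰⇒> too-big)
        where
        c*[q+1]≡qc+c : c * (suc q + 1) ≡ suc q * c + c
        c*[q+1]≡qc+c = trans (*-comm c (suc q + 1))
                             (trans (*-distribʳ-+ c (suc q) 1) (cong (suc q * c +_) (*-identityˡ c)))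
      cG+Q≤e : cG + Q ≤ e
      cG+Q≤e = subst (cG + Q ≤_) (m+[n∸m]≡n cG≤e) (+-monoʳ-≤ cG Q≤e∸cG)
      cG<s : cG < (e + 1) ∸ Q
      cG<s = m+n≤o⇒m≤o∸n (suc cG) (subst (_≤ e + 1) (+-comm (cG + Q) 1) (+-monoˡ-≤ 1 cG+Q≤e))
      admissible : Admissible G rank-ordering ((e + 1) ∸ Q)
      admissible = rank-ordering-admissible (suc q) N+1≤qc+c (*-mono-≤ {1} {suc q} (s≤s z≤n) 1≤ν)
                                            (≤-trans Q≤e∸cG (m∸n≤m e cG))

lemma3p5 : ∀ {n : ℕ} (H G : Graph n) (ν cG cH : ℕ) →
    G ⊆G H → 1 ≤ ∣E∣ G → IsMatchingNumber G ν → IsCms G cG → IsCms H cH →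
    (cH * ∣E∣ G ≤ ν * ∣E∣ H)
    × (cH * (((∣E∣ G ∸ cG) div ν) + 1) ≤ ∣E∣ H)
lemma3p5 H G zero cG cH G⊆H 1≤e (_ , matching-bound) _ _ =
  ⊥-elim (1+n≰n (matching-bound (fromℕ< 1≤e ∷ []) (([] ∷ []) , ([] ∷ []))))
lemma3p5 H G ν@(suc _) cG cH G⊆H _ (_ , matching-bound)
         ((_ , (_ , cG≤e , _)) , cG-max) ((ℓ , (_ , cH≤N , separated)) , _) =
  c*e≤ν*N ,
  c*[q+1]≤N cG cG≤e cG-max ((∣E∣ G ∸ cG) / ν) (s≤s z≤n) (m/n*n≤m (∣E∣ G ∸ cG) ν)
  where open Bounds H G G⊆H ν matching-bound cH ℓ cH≤N separated
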